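{- Let $k$ be a positive integer and let $L_{2k}$ be the ladder graph of order $2k$. Then $L_{2k}$ admits a $2$-graceful $\alpha$-labeling if and only if $k$ is even.
   Context: The ladder graph $L_{2k}$ is the cartesian product $P_2\times P_k$ of the path $P_2=(0\sim 1)$ with the path $P_k=(0\sim 1\sim\cdots\sim k-1)$; it has $2k$ vertices and $3k-2$ edges. For a graph $\Gamma$ of size $e$ and a divisor $d$ of $e$ with $e=d\cdot m$, a $d$-graceful labeling of $\Gamma$ is an injective function $f:V(\Gamma)\to\{0,1,\ldots,d(m+1)-1\}$ such that $\{|f(x)-f(y)| : [x,y]\in E(\Gamma)\}=\{1,2,\ldots,d(m+1)-1\}\setminus\{m+1,2(m+1),\ldots,(d-1)(m+1)\}$; this notion is only defined when $d$ divides $e$ (so no $d$-graceful labeling exists otherwise). If $\Gamma$ is bipartite with parts $X,Y$, a $d$-graceful $\alpha$-labeling is a $d$-graceful labeling $f$ such that $\max f(X)<\min f(Y)$ for a suitable ordering of the two parts. -}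

module Defs where

open import Data.Nat using (ℕ; zero; suc; _+_; _*_; _∸_; _≤_; _<_; ∣_-_∣)
open import Data.Fin using (Fin; inject₁) renaming (zero to fzero; suc to fsuc)
open import Data.List using (List; []; _++_; map; length; allFin)
open import Data.List.Membership.Propositional using (_∈_)
open import Data.Product using (_×_; _,_; Σ; ∃; ∃-syntax)
open import Data.Bool using (Bool; true; false)
open import Relation.Binary.PropositionalEquality using (_≡_; _≢_)
open import Relation.Nullary using (¬_)
open import Function.Definitions using (Injective)

-- A finite graph: a vertex type and its list of edges (each edge listed once,
-- so the size e of the graph is the length of the list).
record Graph : Set₁ where
  field
    V : Set
    E : List (V × V)
open Graph public

-- Ladder L_{2k} = P_2 × P_k, vertices (i , j) with i ∈ {0,1}, j ∈ {0..k-1}.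
LV : ℕ → Set
LV k = Fin 2 × Fin k

ladderEdges : (k : ℕ) → List (LV k × LV k)
ladderEdges zero = []
ladderEdges (suc n) = rungs ++ (rails fzero ++ rails (fsuc fzero))
  where
  rungs : List (LV (suc n) × LV (suc n))
  rungs = map (λ j → ((fzero , j) , (fsuc fzero , j))) (allFin (suc n))
  rails : Fin 2 → List (LV (suc n) × LV (suc n))
  rails i = map (λ j → ((i , inject₁ j) , (i , fsuc j))) (allFin n)

Ladder : ℕ → Graph
Ladder k = record { V = LV k ; E = ladderEdges k }

-- The admissible edge-label set for d-graceful labelings with e = d·m:
-- {1, …, d(m+1)-1} \ {m+1, 2(m+1), …, (d-1)(m+1)}.
Admissible : (d m t : ℕ) → Set
Admissible d m t =
  (1 ≤ t) × (t ≤ d * (m + 1) ∸ 1) ×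
  ¬ (Σ ℕ λ i → (1 ≤ i) × (i ≤ d ∸ 1) × (t ≡ i * (m + 1)))

record IsDGraceful (Γ : Graph) (d m : ℕ) (f : V Γ → ℕ) : Set where
  field
    size     : length (E Γ) ≡ d * m
    injective : Injective _≡_ _≡_ f
    range    : ∀ x → f x < d * (m + 1)
    labels⊆  : ∀ {x y} → (x , y) ∈ E Γ → Admissible d m ∣ f x - f y ∣
    labels⊇  : ∀ t → Admissible d m t →
               Σ (V Γ) λ x → Σ (V Γ) λ y → ((x , y) ∈ E Γ) × (∣ f x - f y ∣ ≡ t)

-- A bipartition of Γ given by a proper 2-colouring (X = colour false, Y = colour true).
IsBipartition : (Γ : Graph) → (V Γ → Bool) → Set
IsBipartition Γ c = ∀ {x y} → (x , y) ∈ E Γ → c x ≢ c y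

-- d-graceful α-labeling: d-graceful and max f(X) < min f(Y) for some
-- bipartition (X , Y) (the choice of colouring covers both orderings of the parts).
HasDGracefulα : (Γ : Graph) (d : ℕ) → Set
HasDGracefulα Γ d =
  Σ ℕ λ m → Σ (V Γ → ℕ) λ f → Σ (V Γ → Bool) λ c →
    IsDGraceful Γ d m f × IsBipartition Γ c ×
    (∀ x y → c x ≡ false → c y ≡ true → f x < f y)

module Submission where

open import Defs
open import Data.Nat using (ℕ; _≤_)
open import Data.Nat.Divisibility using (_∣_)
open import Function.Bundles using (_⇔_)

open import Data.Nat using (zero; suc; _+_; _*_; _∸_; _<_; z≤n; s≤s; ∣_-_∣; ⌊_/2⌋; _<?_; _≤?_)
open import Data.Nat.Properties
open import Data.Nat.Divisibility using (divides; ∣m+n∣m⇒∣n)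
open import Data.Nat.Tactic.RingSolver using (solve)
open import Data.Fin using (Fin; toℕ; fromℕ<; inject₁) renaming (zero to fzero; suc to fsuc)
open import Data.Fin.Properties using (toℕ-fromℕ<; toℕ-inject₁; toℕ-injective; toℕ<n)
open import Data.List using (List; []; _∷_; _++_; map; length; allFin)
open import Data.List.Properties using (length-++; length-map; length-tabulate)
open import Data.List.Membership.Propositional using (_∈_)
open import Data.List.Membership.Propositional.Properties
  using (∈-++⁺ˡ; ∈-++⁺ʳ; ∈-++⁻; ∈-map⁺; ∈-map⁻; ∈-allFin)
open import Data.Product using (Σ; _×_; _,_; proj₁; proj₂)
open import Data.Product.Properties using (,-injective)
open import Data.Sum using (inj₁; inj₂)
open import Data.Bool using (Bool; true; false; if_then_else_; not)
open import Data.Bool.Properties using (not-¬; not-involutive)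
open import Relation.Binary.PropositionalEquality
open import Relation.Binary.Definitions using (tri<; tri≈; tri>)
open import Relation.Nullary using (yes; no; contradiction)
open import Function using (id; _∘_; mk⇔)
open import Function.Definitions using (Injective)

-- Necessity is a counting argument: a 2-graceful labeling needs an even number
-- 2m of edges, and L_{2k} has 3k − 2 edges.
--
-- Sufficiency is an explicit construction for k = 2p + 2, m = 3p + 2.  Class X consists of
-- the vertices (a, c) with a ≡ c (mod 2), labelled by their column c < k; class Y is
-- labelled m − ⌊c/2⌋ on row 1 and (m + 1) + (m − ⌊c/2⌋) on row 0, all at least k, which
-- gives the α-property.  For d = 2 the admissible edge labels are u and (m + 1) + u with
-- 1 ≤ u ≤ m, and u = c + 3r runs over three residue classes modulo 3.  The edges fall
-- into six families (rungs and rails at even and odd columns), each realising exactly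
-- one residue class on one side; this yields both inclusions between the edge labels
-- and the admissible labels.  Injectivity of the labelling follows from an explicit
-- left inverse.

rungEdge : ∀ n → Fin (suc n) → LV (suc n) × LV (suc n)
rungEdge n j = ((fzero , j) , (fsuc fzero , j))

railEdge : ∀ n → Fin 2 → Fin n → LV (suc n) × LV (suc n)
railEdge n a j = ((a , inject₁ j) , (a , fsuc j))

data LadderEdge (n : ℕ) : LV (suc n) → LV (suc n) → Set where
  rung : (j : Fin (suc n)) → LadderEdge n (fzero , j) (fsuc fzero , j)
  rail : (a : Fin 2) (j : Fin n) → LadderEdge n (a , inject₁ j) (a , fsuc j)

ladderEdge-sound : ∀ n {x y} → LadderEdge n x y → (x , y) ∈ ladderEdges (suc n)
ladderEdge-sound n (rung j) = ∈-++⁺ˡ (∈-map⁺ (rungEdge n) (∈-allFin j))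
ladderEdge-sound n (rail fzero j) =
  ∈-++⁺ʳ (map (rungEdge n) (allFin (suc n))) (∈-++⁺ˡ (∈-map⁺ (railEdge n fzero) (∈-allFin j)))
ladderEdge-sound n (rail (fsuc fzero) j) =
  ∈-++⁺ʳ (map (rungEdge n) (allFin (suc n)))
    (∈-++⁺ʳ (map (railEdge n fzero) (allFin n)) (∈-map⁺ (railEdge n (fsuc fzero)) (∈-allFin j)))

ladderEdge-complete : ∀ n {x y} → (x , y) ∈ ladderEdges (suc n) → LadderEdge n x y
ladderEdge-complete n e with ∈-++⁻ (map (rungEdge n) (allFin (suc n))) e
... | inj₁ e′ with ∈-map⁻ (rungEdge n) e′
...   | j , _ , refl = rung j
ladderEdge-complete n e | inj₂ e′ with ∈-++⁻ (map (railEdge n fzero) (allFin n)) e′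
... | inj₁ e″ with ∈-map⁻ (railEdge n fzero) e″
...   | j , _ , refl = rail fzero j
ladderEdge-complete n e | inj₂ e′ | inj₂ e″ with ∈-map⁻ (railEdge n (fsuc fzero)) e″
...   | j , _ , refl = rail (fsuc fzero) j

ladder-size : ∀ n → length (ladderEdges (suc n)) ≡ suc n + (n + n)
ladder-size n = begin
  length (rungs ++ (rails fzero ++ rails (fsuc fzero)))
    ≡⟨ length-++ rungs ⟩
  length rungs + length (rails fzero ++ rails (fsuc fzero))
    ≡⟨ cong (length rungs +_) (length-++ (rails fzero)) ⟩
  length rungs + (length (rails fzero) + length (rails (fsuc fzero)))
    ≡⟨ cong₂ _+_ (columns (rungEdge n))
                 (cong₂ _+_ (columns (railEdge n fzero)) (columns (railEdge n (fsuc fzero)))) ⟩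
  suc n + (n + n) ∎
  where
  open ≡-Reasoning
  rungs = map (rungEdge n) (allFin (suc n))
  rails : Fin 2 → List (LV (suc n) × LV (suc n))
  rails a = map (railEdge n a) (allFin n)
  columns : ∀ {c} (f : Fin c → LV (suc n) × LV (suc n)) → length (map f (allFin c)) ≡ c
  columns {c} f = trans (length-map f (allFin c)) (length-tabulate id)

even-size⇒even-length : ∀ n m → length (ladderEdges (suc n)) ≡ 2 * m → 2 ∣ suc n
even-size⇒even-length n m size = ∣m+n∣m⇒∣n 2∣[n+n]+[1+n] (divides n (solve (n ∷ [])))
  where
  open ≡-Reasoning
  2∣[n+n]+[1+n] : 2 ∣ (n + n) + suc n
  2∣[n+n]+[1+n] = divides m (begin
    (n + n) + suc n                ≡⟨ +-comm (n + n) (suc n) ⟩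
    suc n + (n + n)                ≡⟨ ladder-size n ⟨
    length (ladderEdges (suc n))   ≡⟨ size ⟩
    2 * m                          ≡⟨ *-comm 2 m ⟩
    m * 2                          ∎)

-- Order and distance facts witnessed by an explicit difference, which is
-- then checked by the ring solver at each use.
≤-witness : ∀ {a b} c → b ≡ a + c → a ≤ b
≤-witness {a} c refl = m≤m+n a c

distance : ∀ a c {b} → b ≡ a + c → ∣ a - b ∣ ≡ c
distance a c refl = ∣m-m+n∣≡n a c

distance′ : ∀ b c {a} → a ≡ b + c → ∣ a - b ∣ ≡ c
distance′ b c {a} a≡b+c = trans (∣-∣-comm a b) (distance b c a≡b+c)

-- Admissible labels for d = 2: the set {1, …, 2m+1} \ {m+1}, i.e. the
-- numbers u ("low") and (m+1) + u ("high") with 1 ≤ u ≤ m.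
data Side : Set where
  low high : Side

place : Side → ℕ → ℕ → ℕ
place low  m u = u
place high m u = suc m + u

unit-multiple : ∀ m → 1 * (m + 1) ≡ suc m
unit-multiple m = solve (m ∷ [])

forbidden≡1+m : ∀ {m t} → Σ ℕ (λ i → (1 ≤ i) × (i ≤ 2 ∸ 1) × (t ≡ i * (m + 1))) → t ≡ suc m
forbidden≡1+m (zero , () , _)
forbidden≡1+m {m} (1 , _ , _ , t≡) = trans t≡ (unit-multiple m)
forbidden≡1+m (suc (suc _) , _ , s≤s () , _)

double-size : ∀ m → 2 * (m + 1) ≡ suc (suc m + m)
double-size m = solve (m ∷ [])

largest-label : ∀ m → 2 * (m + 1) ∸ 1 ≡ suc m + m
largest-label m = cong (_∸ 1) (double-size m)

admissible-place : ∀ s m u → 1 ≤ u → u ≤ m → Admissible 2 m (place s m u)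
admissible-place low m u 1≤u u≤m =
  1≤u ,
  subst (u ≤_) (sym (largest-label m)) (≤-trans u≤m (m≤n+m m (suc m))) ,
  λ forbidden → <-irrefl (forbidden≡1+m forbidden) (s≤s u≤m)
admissible-place high m u 1≤u u≤m =
  s≤s z≤n ,
  subst (suc m + u ≤_) (sym (largest-label m)) (+-monoʳ-≤ (suc m) u≤m) ,
  λ forbidden → <-irrefl (sym (forbidden≡1+m forbidden)) (m<m+n (suc m) 1≤u)

admissible-split : ∀ m t → Admissible 2 m t →
                   Σ Side λ s → Σ ℕ λ u → (1 ≤ u) × (u ≤ m) × (t ≡ place s m u)
admissible-split m t (1≤t , t≤2m+1 , not-forbidden) with <-cmp t (suc m)
... | tri< t<1+m _ _ = low , t , 1≤t , ≤-pred t<1+m , refl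
... | tri≈ _ t≡1+m _ =
  contradiction (1 , s≤s z≤n , s≤s z≤n , trans t≡1+m (sym (unit-multiple m))) not-forbidden
... | tri> _ _ 1+m<t with m≤n⇒∃[o]m+o≡n (<⇒≤ 1+m<t)
...   | u , refl = high , u , 1≤u , u≤m , refl
  where
  1≤u : 1 ≤ u
  1≤u = +-cancelˡ-< (suc m) 0 u (subst (_< suc m + u) (sym (+-identityʳ (suc m))) 1+m<t)
  u≤m : u ≤ m
  u≤m = +-cancelˡ-≤ (suc m) u m (subst (suc m + u ≤_) (largest-label m) t≤2m+1)

-- Residues modulo 3: the numbers 1, …, 3p+2 are exactly c + 3r with c ∈ {1,2}, r ≤ p, or
-- c = 3, r < p.  The complement i = p − r (resp. p − 1 − r) is recorded as well: the
-- label c + 3r will be realised by an edge at column 2i or 2i + 1.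
data Residue (p : ℕ) : ℕ → Set where
  one   : ∀ i r → i + r ≡ p → Residue p (1 + r * 3)
  two   : ∀ i r → i + r ≡ p → Residue p (2 + r * 3)
  three : ∀ i r → suc (i + r) ≡ p → Residue p (3 + r * 3)

residue-step : ∀ {p u} → Residue p u → Residue (suc p) (3 + u)
residue-step (one i r e)   = one i (suc r) (trans (+-suc i r) (cong suc e))
residue-step (two i r e)   = two i (suc r) (trans (+-suc i r) (cong suc e))
residue-step (three i r e) = three i (suc r) (cong suc (trans (+-suc i r) e))

residue : ∀ p u → 1 ≤ u → u ≤ 2 + p * 3 → Residue p u
residue p 1 _ _ = one p 0 (+-identityʳ p)
residue p 2 _ _ = two p 0 (+-identityʳ p)
residue zero (suc (suc (suc _))) _ (s≤s (s≤s ()))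
residue (suc p) 3 _ _ = three p 0 (cong suc (+-identityʳ p))
residue (suc p) (suc (suc (suc u@(suc _)))) _ (s≤s (s≤s (s≤s u≤2+3p))) =
  residue-step (residue p u (s≤s z≤n) u≤2+3p)

residue-bounds : ∀ {p u} → Residue p u → 1 ≤ u × u ≤ 2 + p * 3
residue-bounds (one i r refl)   = s≤s z≤n , ≤-witness (1 + i * 3) (solve (i ∷ r ∷ []))
residue-bounds (two i r refl)   = s≤s z≤n , ≤-witness (i * 3) (solve (i ∷ r ∷ []))
residue-bounds (three i r refl) = s≤s z≤n , ≤-witness (2 + i * 3) (solve (i ∷ r ∷ []))

isOdd : ℕ → Bool
isOdd zero    = false
isOdd (suc n) = not (isOdd n)

isOdd-double : ∀ i → isOdd (i * 2) ≡ false
isOdd-double zero    = refl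
isOdd-double (suc i) = cong (not ∘ not) (isOdd-double i)

half-double : ∀ i → ⌊ i * 2 /2⌋ ≡ i
half-double zero    = refl
half-double (suc i) = cong suc (half-double i)

half-double+1 : ∀ i → ⌊ suc (i * 2) /2⌋ ≡ i
half-double+1 zero    = refl
half-double+1 (suc i) = cong suc (half-double+1 i)

double-half : ∀ c → isOdd c ≡ false → ⌊ c /2⌋ * 2 ≡ c
double-half zero          _    = refl
double-half (suc (suc c)) c-even =
  cong (suc ∘ suc) (double-half c (trans (sym (not-involutive (isOdd c))) c-even))

double-half+1 : ∀ c → isOdd c ≡ true → suc (⌊ c /2⌋ * 2) ≡ c
double-half+1 (suc zero)    _   = refl
double-half+1 (suc (suc c)) c-odd =
  cong (suc ∘ suc) (double-half+1 c (trans (sym (not-involutive (isOdd c))) c-odd))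

-- The ladder L_{2k} with k = 2p + 2 columns, and its half size m = (3k − 2)/2 = 3p + 2.
width : ℕ → ℕ
width p = suc (suc (p * 2))

halfSize : ℕ → ℕ
halfSize p = 2 + p * 3

yLabel : ℕ → ℕ → ℕ
yLabel m c = m ∸ ⌊ c /2⌋

vertexLabel : ℕ → Fin 2 → ℕ → ℕ
vertexLabel m fzero    c = if isOdd c then suc m + yLabel m c else c
vertexLabel m (fsuc _) c = if isOdd c then c else yLabel m c

colourOf : Fin 2 → ℕ → Bool
colourOf fzero    c = isOdd c
colourOf (fsuc _) c = not (isOdd c)

labelling : ∀ {k} → ℕ → LV k → ℕ
labelling m (a , j) = vertexLabel m a (toℕ j)

colouring : ∀ {k} → LV k → Bool
colouring (a , j) = colourOf a (toℕ j)

colouring-proper : ∀ n → IsBipartition (Ladder (suc n)) colouring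
colouring-proper n e with ladderEdge-complete n e
... | rung j                                = not-¬ refl
... | rail fzero j       rewrite toℕ-inject₁ j = not-¬ refl
... | rail (fsuc fzero) j rewrite toℕ-inject₁ j = not-¬ refl

X-label : ∀ m a c → colourOf a c ≡ false → vertexLabel m a c ≡ c
X-label m fzero c isX with isOdd c | isX
... | false | _  = refl
... | true  | ()
X-label m (fsuc _) c isX with isOdd c | isX
... | true  | _  = refl
... | false | ()

-- In L_{2(p+1)} every column c satisfies ⌊c/2⌋ ≤ p, hence the Y labels
-- m − ⌊c/2⌋ lie between k = m − p and m, and determine ⌊c/2⌋.
half≤ : ∀ p c → c < width p → ⌊ c /2⌋ ≤ p
half≤ p c (s≤s c≤1+2p) = subst (⌊ c /2⌋ ≤_) (half-double+1 p) (⌊n/2⌋-mono c≤1+2p)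

halfSize∸p : ∀ p → halfSize p ∸ p ≡ width p
halfSize∸p p = trans (cong (_∸ p) split) (m+n∸m≡n p (width p))
  where
  split : 2 + p * 3 ≡ p + suc (suc (p * 2))
  split = solve (p ∷ [])

width≤yLabel : ∀ p c → c < width p → width p ≤ yLabel (halfSize p) c
width≤yLabel p c c<k = begin
  width p                ≡⟨ halfSize∸p p ⟨
  halfSize p ∸ p         ≤⟨ ∸-monoʳ-≤ (halfSize p) (half≤ p c c<k) ⟩
  halfSize p ∸ ⌊ c /2⌋   ∎
  where open ≤-Reasoning

yLabel-inverse : ∀ p c → c < width p → halfSize p ∸ yLabel (halfSize p) c ≡ ⌊ c /2⌋
yLabel-inverse p c c<k = m∸[m∸n]≡n (≤-trans (half≤ p c c<k) (≤-witness (2 + p * 2) split))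
  where
  split : 2 + p * 3 ≡ p + (2 + p * 2)
  split = solve (p ∷ [])

X-below : ∀ p a c → c < width p → colourOf a c ≡ false → vertexLabel (halfSize p) a c < width p
X-below p a c c<k isX = subst (_< width p) (sym (X-label (halfSize p) a c isX)) c<k

Y-above : ∀ p a c → c < width p → colourOf a c ≡ true → width p ≤ vertexLabel (halfSize p) a c
Y-above p fzero c c<k isY with isOdd c | isY
... | true  | _  = ≤-trans (width≤yLabel p c c<k) (m≤n+m _ (suc (halfSize p)))
... | false | ()
Y-above p (fsuc _) c c<k isY with isOdd c | isY
... | false | _  = width≤yLabel p c c<k
... | true  | ()

width≤2m+1 : ∀ p → width p ≤ suc (halfSize p) + halfSize p
width≤2m+1 p = ≤-witness (3 + p * 4) split
  where
  split : suc (2 + p * 3) + (2 + p * 3) ≡ suc (suc (p * 2)) + (3 + p * 4)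
  split = solve (p ∷ [])

label≤2m+1 : ∀ p a c → c < width p → vertexLabel (halfSize p) a c ≤ suc (halfSize p) + halfSize p
label≤2m+1 p fzero c c<k with isOdd c
... | true  = +-monoʳ-≤ (suc (halfSize p)) (m∸n≤m (halfSize p) ⌊ c /2⌋)
... | false = ≤-trans (<⇒≤ c<k) (width≤2m+1 p)
label≤2m+1 p (fsuc _) c c<k with isOdd c
... | true  = ≤-trans (<⇒≤ c<k) (width≤2m+1 p)
... | false = ≤-trans (m∸n≤m (halfSize p) ⌊ c /2⌋) (m≤n+m (halfSize p) (suc (halfSize p)))

labelling-range : ∀ p (x : LV (width p)) → labelling (halfSize p) x < 2 * (halfSize p + 1)
labelling-range p (a , j) =
  subst (labelling (halfSize p) (a , j) <_) (sym (double-size (halfSize p)))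
        (s≤s (label≤2m+1 p a (toℕ j) (toℕ<n j)))

labelling-α : ∀ p (x y : LV (width p)) → colouring x ≡ false → colouring y ≡ true →
              labelling (halfSize p) x < labelling (halfSize p) y
labelling-α p (a , j) (b , j′) isX isY =
  <-≤-trans (X-below p a (toℕ j) (toℕ<n j) isX) (Y-above p b (toℕ j′) (toℕ<n j′) isY)

-- A label l < k is an
-- X label (its own column; the row is the parity of l), a label in [k, m] a row-1
-- Y label m − i of column 2i, and a label above m a row-0 Y label (m+1) + (m − i) of
-- column 2i + 1.
rowBit : ℕ → ℕ
rowBit c = if isOdd c then 1 else 0

decode : (m k l : ℕ) → ℕ × ℕ
decode m k l with l <? k | l ≤? m
... | yes _ | _     = rowBit l , l
... | no _  | yes _ = 1 , (m ∸ l) * 2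
... | no _  | no _  = 0 , suc ((m ∸ (l ∸ suc m)) * 2)

decode-X : ∀ {m k l} → l < k → decode m k l ≡ (rowBit l , l)
decode-X {m} {k} {l} l<k with l <? k | l ≤? m
... | yes _   | _ = refl
... | no l≮k  | _ = contradiction l<k l≮k

decode-Y₁ : ∀ {m k l} → k ≤ l → l ≤ m → decode m k l ≡ (1 , (m ∸ l) * 2)
decode-Y₁ {m} {k} {l} k≤l l≤m with l <? k | l ≤? m
... | yes l<k | _       = contradiction l<k (≤⇒≯ k≤l)
... | no _    | yes _   = refl
... | no _    | no l≰m  = contradiction l≤m l≰m

decode-Y₀ : ∀ {m k l} → k ≤ l → m < l → decode m k l ≡ (0 , suc ((m ∸ (l ∸ suc m)) * 2))
decode-Y₀ {m} {k} {l} k≤l m<l with l <? k | l ≤? m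
... | yes l<k | _       = contradiction l<k (≤⇒≯ k≤l)
... | no _    | yes l≤m = contradiction l≤m (<⇒≱ m<l)
... | no _    | no _    = refl

decode-label : ∀ p a c → c < width p →
               decode (halfSize p) (width p) (vertexLabel (halfSize p) a c) ≡ (toℕ a , c)
decode-label p fzero c c<k with isOdd c in parity
... | false = trans (decode-X c<k) (cong (λ b → (if b then 1 else 0) , c) parity)
... | true  = begin
  decode m k (suc m + yLabel m c)
    ≡⟨ decode-Y₀ (≤-trans (width≤yLabel p c c<k) (m≤n+m _ (suc m))) (s≤s (m≤m+n m _)) ⟩
  (0 , suc ((m ∸ (suc m + yLabel m c ∸ suc m)) * 2))
    ≡⟨ cong (λ l → 0 , suc ((m ∸ l) * 2)) (m+n∸m≡n (suc m) (yLabel m c)) ⟩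
  (0 , suc ((m ∸ yLabel m c) * 2))
    ≡⟨ cong (λ h → 0 , suc (h * 2)) (yLabel-inverse p c c<k) ⟩
  (0 , suc (⌊ c /2⌋ * 2))
    ≡⟨ cong (0 ,_) (double-half+1 c parity) ⟩
  (0 , c) ∎
  where
  open ≡-Reasoning
  m = halfSize p
  k = width p
decode-label p (fsuc fzero) c c<k with isOdd c in parity
... | true  = trans (decode-X c<k) (cong (λ b → (if b then 1 else 0) , c) parity)
... | false = begin
  decode m k (yLabel m c)
    ≡⟨ decode-Y₁ (width≤yLabel p c c<k) (m∸n≤m m ⌊ c /2⌋) ⟩
  (1 , (m ∸ yLabel m c) * 2)
    ≡⟨ cong (λ h → 1 , h * 2) (yLabel-inverse p c c<k) ⟩
  (1 , ⌊ c /2⌋ * 2)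
    ≡⟨ cong (1 ,_) (double-half c parity) ⟩
  (1 , c) ∎
  where
  open ≡-Reasoning
  m = halfSize p
  k = width p

labelling-injective : ∀ p → Injective _≡_ _≡_ (labelling {width p} (halfSize p))
labelling-injective p {a , j} {b , j′} same-label =
  cong₂ _,_ (toℕ-injective (proj₁ same-coordinates)) (toℕ-injective (proj₂ same-coordinates))
  where
  open ≡-Reasoning
  f = labelling (halfSize p)
  f⁻¹ = decode (halfSize p) (width p)
  same-coordinates : toℕ a ≡ toℕ b × toℕ j ≡ toℕ j′
  same-coordinates = ,-injective (begin
    (toℕ a , toℕ j)      ≡⟨ decode-label p a (toℕ j) (toℕ<n j) ⟨
    f⁻¹ (f (a , j))      ≡⟨ cong f⁻¹ same-label ⟩
    f⁻¹ (f (b , j′))     ≡⟨ decode-label p b (toℕ j′) (toℕ<n j′) ⟩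
    (toℕ b , toℕ j′)     ∎)

data Column (p : ℕ) : ℕ → Set where
  even : ∀ i r → i + r ≡ p → Column p (i * 2)
  odd  : ∀ i r → i + r ≡ p → Column p (suc (i * 2))

column : ∀ p c → c < width p → Column p c
column p       0             _               = even 0 p refl
column p       1             _               = odd 0 p refl
column zero    (suc (suc _)) (s≤s (s≤s ()))
column (suc p) (suc (suc c)) (s≤s (s≤s c<k)) with column p c c<k
... | even i r e = even (suc i) r (cong suc e)
... | odd  i r e = odd  (suc i) r (cong suc e)

data RailStart (p : ℕ) : ℕ → Set where
  even : ∀ i r → i + r ≡ p → RailStart p (i * 2)
  odd  : ∀ i r → suc (i + r) ≡ p → RailStart p (suc (i * 2))

railStart : ∀ p c → c < suc (p * 2) → RailStart p c
railStart p       0             _              = even 0 p refl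
railStart zero    (suc _)       (s≤s ())
railStart (suc p) 1             _              = odd 0 p refl
railStart (suc p) (suc (suc c)) (s≤s (s≤s c<)) with railStart p c c<
... | even i r e = even (suc i) r (cong suc e)
... | odd  i r e = odd  (suc i) r (cong suc e)

label-even-row0 : ∀ m i → vertexLabel m fzero (i * 2) ≡ i * 2
label-even-row0 m i rewrite isOdd-double i = refl

label-even-row1 : ∀ m i a → vertexLabel m (fsuc a) (i * 2) ≡ m ∸ i
label-even-row1 m i a rewrite isOdd-double i | half-double i = refl

label-odd-row0 : ∀ m i → vertexLabel m fzero (suc (i * 2)) ≡ suc m + (m ∸ i)
label-odd-row0 m i rewrite isOdd-double i | half-double+1 i = refl

label-odd-row1 : ∀ m i a → vertexLabel m (fsuc a) (suc (i * 2)) ≡ suc (i * 2)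
label-odd-row1 m i a rewrite isOdd-double i = refl

mirror : ∀ {p} i r → i + r ≡ p → halfSize p ∸ i ≡ 2 + i * 2 + r * 3
mirror i r refl = trans (cong (_∸ i) split) (m+n∸m≡n i (2 + i * 2 + r * 3))
  where
  split : 2 + (i + r) * 3 ≡ i + (2 + i * 2 + r * 3)
  split = solve (i ∷ r ∷ [])

rungLabel : ℕ → ℕ → ℕ
rungLabel m c = ∣ vertexLabel m fzero c - vertexLabel m (fsuc fzero) c ∣

railLabel : ℕ → Fin 2 → ℕ → ℕ
railLabel m a c = ∣ vertexLabel m a c - vertexLabel m a (suc c) ∣

rail-edge-label : ∀ {k} m a (j : Fin k) →
                  ∣ labelling m (a , inject₁ j) - labelling m (a , fsuc j) ∣ ≡ railLabel m a (toℕ j)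
rail-edge-label m a j =
  cong (λ c → ∣ vertexLabel m a c - vertexLabel m a (suc (toℕ j)) ∣) (toℕ-inject₁ j)

-- The six edge families (p = i + r, resp. p = i + r + 1 for rails leaving an odd column).
-- Each realises one residue class c + 3r on one side: even rungs and row-1 rails give
-- the low labels, odd rungs and row-0 rails the high ones.
rung-even : ∀ i r → rungLabel (halfSize (i + r)) (i * 2) ≡ 2 + r * 3
rung-even i r =
  trans (cong₂ ∣_-_∣ (label-even-row0 m i) (trans (label-even-row1 m i fzero) (mirror i r refl)))
        (distance (i * 2) (2 + r * 3) gap)
  where
  m = halfSize (i + r)
  gap : 2 + i * 2 + r * 3 ≡ i * 2 + (2 + r * 3)
  gap = solve (i ∷ r ∷ [])

rung-odd : ∀ i r → rungLabel (halfSize (i + r)) (suc (i * 2)) ≡ suc (halfSize (i + r)) + (1 + r * 3)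
rung-odd i r =
  trans (cong₂ ∣_-_∣ (trans (label-odd-row0 m i) (cong (suc m +_) (mirror i r refl)))
                     (label-odd-row1 m i fzero))
        (distance′ (suc (i * 2)) (3 + (i + r) * 3 + (1 + r * 3)) gap)
  where
  m = halfSize (i + r)
  gap : 3 + (i + r) * 3 + (2 + i * 2 + r * 3) ≡ suc (i * 2) + (3 + (i + r) * 3 + (1 + r * 3))
  gap = solve (i ∷ r ∷ [])

rail-even-row0 : ∀ i r → railLabel (halfSize (i + r)) fzero (i * 2) ≡ suc (halfSize (i + r)) + (2 + r * 3)
rail-even-row0 i r =
  trans (cong₂ ∣_-_∣ (label-even-row0 m i) (trans (label-odd-row0 m i) (cong (suc m +_) (mirror i r refl))))
        (distance (i * 2) (3 + (i + r) * 3 + (2 + r * 3)) gap)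
  where
  m = halfSize (i + r)
  gap : 3 + (i + r) * 3 + (2 + i * 2 + r * 3) ≡ i * 2 + (3 + (i + r) * 3 + (2 + r * 3))
  gap = solve (i ∷ r ∷ [])

rail-odd-row0 : ∀ i r → railLabel (halfSize (suc (i + r))) fzero (suc (i * 2))
                        ≡ suc (halfSize (suc (i + r))) + (3 + r * 3)
rail-odd-row0 i r =
  trans (cong₂ ∣_-_∣ (trans (label-odd-row0 m i) (cong (suc m +_) (mirror i (suc r) (+-suc i r))))
                     (label-even-row0 m (suc i)))
        (distance′ (suc i * 2) (3 + suc (i + r) * 3 + (3 + r * 3)) gap)
  where
  m = halfSize (suc (i + r))
  gap : 3 + suc (i + r) * 3 + (2 + i * 2 + suc r * 3) ≡ suc i * 2 + (3 + suc (i + r) * 3 + (3 + r * 3))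
  gap = solve (i ∷ r ∷ [])

rail-even-row1 : ∀ i r → railLabel (halfSize (i + r)) (fsuc fzero) (i * 2) ≡ 1 + r * 3
rail-even-row1 i r =
  trans (cong₂ ∣_-_∣ (trans (label-even-row1 m i fzero) (mirror i r refl)) (label-odd-row1 m i fzero))
        (distance′ (suc (i * 2)) (1 + r * 3) gap)
  where
  m = halfSize (i + r)
  gap : 2 + i * 2 + r * 3 ≡ suc (i * 2) + (1 + r * 3)
  gap = solve (i ∷ r ∷ [])

rail-odd-row1 : ∀ i r → railLabel (halfSize (suc (i + r))) (fsuc fzero) (suc (i * 2)) ≡ 3 + r * 3
rail-odd-row1 i r =
  trans (cong₂ ∣_-_∣ (label-odd-row1 m i fzero)
                     (trans (label-even-row1 m (suc i) fzero) (mirror (suc i) r refl)))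
        (distance (suc (i * 2)) (3 + r * 3) gap)
  where
  m = halfSize (suc (i + r))
  gap : 2 + suc i * 2 + r * 3 ≡ suc (i * 2) + (3 + r * 3)
  gap = solve (i ∷ r ∷ [])

Placed : ℕ → ℕ → Set
Placed p t = Σ Side λ s → Σ ℕ λ u → Residue p u × (t ≡ place s (halfSize p) u)

placed⇒admissible : ∀ {p t} → Placed p t → Admissible 2 (halfSize p) t
placed⇒admissible (s , u , ρ , refl) =
  admissible-place s _ u (proj₁ (residue-bounds ρ)) (proj₂ (residue-bounds ρ))

admissible⇒placed : ∀ p t → Admissible 2 (halfSize p) t → Placed p t
admissible⇒placed p t adm with admissible-split (halfSize p) t adm
... | s , u , 1≤u , u≤m , t≡ = s , u , residue p u 1≤u u≤m , t≡

rung-placed : ∀ {p c} → Column p c → Placed p (rungLabel (halfSize p) c)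
rung-placed (even i r refl) = low  , _ , two i r refl , rung-even i r
rung-placed (odd  i r refl) = high , _ , one i r refl , rung-odd i r

rail-placed : ∀ {p c} a → RailStart p c → Placed p (railLabel (halfSize p) a c)
rail-placed fzero        (even i r refl) = high , _ , two i r refl   , rail-even-row0 i r
rail-placed fzero        (odd  i r refl) = high , _ , three i r refl , rail-odd-row0 i r
rail-placed (fsuc fzero) (even i r refl) = low  , _ , one i r refl   , rail-even-row1 i r
rail-placed (fsuc fzero) (odd  i r refl) = low  , _ , three i r refl , rail-odd-row1 i r

EdgeWithLabel : ℕ → ℕ → Set
EdgeWithLabel p t = Σ (LV (width p)) λ x → Σ (LV (width p)) λ y →
  ((x , y) ∈ ladderEdges (width p)) × (∣ labelling (halfSize p) x - labelling (halfSize p) y ∣ ≡ t)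

rung-at : ∀ {p c t} → c < width p → rungLabel (halfSize p) c ≡ t → EdgeWithLabel p t
rung-at {p} c<k label≡t =
  (fzero , j) , (fsuc fzero , j) , ladderEdge-sound _ (rung j) ,
  trans (cong (rungLabel (halfSize p)) (toℕ-fromℕ< c<k)) label≡t
  where j = fromℕ< c<k

rail-at : ∀ {p c t} a → c < suc (p * 2) → railLabel (halfSize p) a c ≡ t → EdgeWithLabel p t
rail-at {p} a c<2p+1 label≡t =
  (a , inject₁ j) , (a , fsuc j) , ladderEdge-sound _ (rail a j) ,
  trans (rail-edge-label (halfSize p) a j)
        (trans (cong (railLabel (halfSize p) a) (toℕ-fromℕ< c<2p+1)) label≡t)
  where j = fromℕ< c<2p+1

-- Column 2i starts a rail when i ≤ p; hence 2i and 2i + 1 are columns, and so is 2i + 2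
-- when i < p.
column-bound : ∀ i r → i * 2 < suc ((i + r) * 2)
column-bound i r = s≤s (*-monoˡ-≤ 2 (m≤m+n i r))

edge-with-label : ∀ {p t} → Placed p t → EdgeWithLabel p t
edge-with-label (low  , _ , one i r refl   , refl) =
  rail-at {i + r} (fsuc fzero) (column-bound i r) (rail-even-row1 i r)
edge-with-label (low  , _ , two i r refl   , refl) =
  rung-at {i + r} (m<n⇒m<1+n (column-bound i r)) (rung-even i r)
edge-with-label (low  , _ , three i r refl , refl) =
  rail-at {suc (i + r)} (fsuc fzero) (s≤s (m≤n⇒m≤1+n (column-bound i r))) (rail-odd-row1 i r)
edge-with-label (high , _ , one i r refl   , refl) =
  rung-at {i + r} (s≤s (column-bound i r)) (rung-odd i r)
edge-with-label (high , _ , two i r refl   , refl) =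
  rail-at {i + r} fzero (column-bound i r) (rail-even-row0 i r)
edge-with-label (high , _ , three i r refl , refl) =
  rail-at {suc (i + r)} fzero (s≤s (m≤n⇒m≤1+n (column-bound i r))) (rail-odd-row0 i r)

labels-admissible : ∀ p {x y} → (x , y) ∈ ladderEdges (width p) →
                    Admissible 2 (halfSize p) ∣ labelling (halfSize p) x - labelling (halfSize p) y ∣
labels-admissible p e with ladderEdge-complete (suc (p * 2)) e
... | rung j   = placed⇒admissible (rung-placed (column p (toℕ j) (toℕ<n j)))
... | rail a j = subst (Admissible 2 (halfSize p)) (sym (rail-edge-label (halfSize p) a j))
                       (placed⇒admissible (rail-placed a (railStart p (toℕ j) (toℕ<n j))))

ladder-α-labelling : ∀ p → HasDGracefulα (Ladder (width p)) 2
ladder-α-labelling p =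
  halfSize p , labelling (halfSize p) , colouring ,
  record { size      = trans (ladder-size (suc (p * 2))) size≡
         ; injective = labelling-injective p
         ; range     = labelling-range p
         ; labels⊆   = labels-admissible p
         ; labels⊇   = λ t adm → edge-with-label (admissible⇒placed p t adm) } ,
  colouring-proper (suc (p * 2)) ,
  labelling-α p
  where
  size≡ : suc (suc (p * 2)) + (suc (p * 2) + suc (p * 2)) ≡ 2 * (2 + p * 3)
  size≡ = solve (p ∷ [])

theorem4p5 : (k : ℕ) → 1 ≤ k → HasDGracefulα (Ladder k) 2 ⇔ (2 ∣ k)
theorem4p5 zero    ()
theorem4p5 (suc n) _ = mk⇔ necessary sufficient
  where
  necessary : HasDGracefulα (Ladder (suc n)) 2 → 2 ∣ suc n
  necessary (m , _ , _ , graceful , _) = even-size⇒even-length n m (IsDGraceful.size graceful)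
  sufficient : 2 ∣ suc n → HasDGracefulα (Ladder (suc n)) 2
  sufficient (divides zero    ())
  sufficient (divides (suc p) 1+n≡2p+2) =
    subst (λ k → HasDGracefulα (Ladder k) 2) (sym 1+n≡2p+2) (ladder-α-labelling p)
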